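{- Let $r\geq 3$ and $k\geq 2$, and let $Wd(r,k)$ be the windmill graph obtained from $k$ disjoint copies of the complete graph $K_r$ by identifying one vertex from each copy into a single vertex $v$. Then $Wd(r,k)$ has exactly $(r-1)^{k}$ minimal forts that contain $v$ and exactly $k\binom{r-1}{2}$ minimal forts that do not contain $v$.
   Context: A fort of a finite simple graph $H$ is a non-empty subset $F$ of its vertices such that no vertex outside $F$ has exactly one neighbor in $F$; a fort is minimal if no proper subset of it is a fort. -}

module Defs where

open import Data.Nat using (ℕ; zero; suc; _*_)
open import Data.Fin using (Fin; zero; suc; quotient)
open import Data.Fin.Subset using (Subset; _∈_; _∉_; _⊂_; Nonempty)
open import Data.Product using (Σ; ∃; _×_; _,_)
open import Data.List using (List; length)
open import Data.List.Relation.Unary.Unique.Propositional using (Unique)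
import Data.List.Membership.Propositional as LMem
open import Relation.Binary.PropositionalEquality using (_≡_; _≢_)
open import Relation.Nullary using (¬_)
open import Function.Bundles using (_⇔_)

record SimpleGraph (n : ℕ) : Set₁ where
  field
    Adj     : Fin n → Fin n → Set
    symm    : ∀ {u w} → Adj u w → Adj w u
    irrefl  : ∀ {u} → ¬ Adj u u

open SimpleGraph public

module _ {n : ℕ} (H : SimpleGraph n) where

  ExactlyOneNbrIn : Subset n → Fin n → Set
  ExactlyOneNbrIn F u =
    ∃ λ w → w ∈ F × Adj H u w × (∀ w′ → w′ ∈ F → Adj H u w′ → w′ ≡ w)

  IsFort : Subset n → Set
  IsFort F = Nonempty F × (∀ u → u ∉ F → ¬ ExactlyOneNbrIn F u)

  IsMinimalFort : Subset n → Set
  IsMinimalFort F = IsFort F × (∀ G → G ⊂ F → ¬ IsFort G)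

HasExactly : {n : ℕ} → (Subset n → Set) → ℕ → Set
HasExactly {n} P m =
  Σ (List (Subset n)) λ L → Unique L × (∀ F → (F LMem.∈ L) ⇔ P F) × length L ≡ m

-- Vertex zero is the centre v; vertex suc i lies in blade (quotient (r-1) i) : Fin k.
-- Each blade together with v induces a copy of K_r.
wdN : ℕ → ℕ → ℕ
wdN r k = suc (k * (r Data.Nat.∸ 1))

data WdAdj (r k : ℕ) : Fin (wdN r k) → Fin (wdN r k) → Set where
  centre-leaf : ∀ i → WdAdj r k zero (suc i)
  leaf-centre : ∀ i → WdAdj r k (suc i) zero
  leaf-leaf   : ∀ i j → i ≢ j →
                quotient {k} (r Data.Nat.∸ 1) i ≡ quotient {k} (r Data.Nat.∸ 1) j →
                WdAdj r k (suc i) (suc j)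

Wd : (r k : ℕ) → SimpleGraph (wdN r k)
Wd r k = record { Adj = WdAdj r k ; symm = sy ; irrefl = ir }
  where
  sy : ∀ {u w} → WdAdj r k u w → WdAdj r k w u
  sy (centre-leaf i) = leaf-centre i
  sy (leaf-centre i) = centre-leaf i
  sy (leaf-leaf i j i≢j q) = leaf-leaf j i (λ e → i≢j (Relation.Binary.PropositionalEquality.sym e))
                                          (Relation.Binary.PropositionalEquality.sym q)
  ir : ∀ {u} → ¬ WdAdj r k u u
  ir (leaf-leaf i .i i≢i _) = i≢i Relation.Binary.PropositionalEquality.refl

centre : (r k : ℕ) → Fin (wdN r k)
centre r k = zero

{-# OPTIONS --safe #-}
module Submission where

-- If the centre v lies in
-- a fort F, every blade meets F, since otherwise a leaf of that blade would see only v; and v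
-- together with one leaf per blade is already a fort, in which no proper subset is a fort. So
-- the minimal forts through v are exactly these "stars", one for each choice of a leaf in every
-- blade: (r - 1) ^ k of them. If v ∉ F, every leaf of F has a blade-mate in F, since otherwise
-- another leaf of that blade would see only it; two leaves of one blade form a fort, minimal
-- because they are adjacent. So the minimal forts avoiding v are the k * C(r - 1, 2) pairs of
-- leaves in a common blade.

open import Defs
open import Data.Nat using (ℕ; zero; suc; _≥_; _*_; _∸_; _^_; _+_; s≤s; z≤n)
open import Data.Nat.Combinatorics using (_C_; nC1≡n; nCk+nC[k+1]≡[n+1]C[k+1])
open import Data.Fin using (Fin; zero; suc; _<_; quotient; remainder; combine)
open import Data.Fin.Properties using (any?; <-cmp; <⇒≢; <-asym; combine-remQuot; remQuot-combine; combine-injectiveˡ; combine-injectiveʳ; suc-injective) renaming (_≟_ to _≟ᶠ_)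
open import Data.Fin.Subset using (Subset; _∈_; _∉_; _⊂_; _⊆_; _∪_; ⁅_⁆)
open import Data.Fin.Subset.Properties using (_∈?_; ⊆-antisym; ∪-comm; x∈p∪q⁻; x∈p∪q⁺; x∈⁅x⁆; x∈⁅y⁆⇒x≡y)
open import Data.Product as Product using (∃; ∃₂; _×_; _,_; proj₁; proj₂)
open import Data.Sum using (_⊎_; inj₁; inj₂; [_,_]′)
open import Data.Empty using (⊥; ⊥-elim)
open import Data.Unit using (⊤; tt)
open import Data.List using (List; []; _∷_; [_]; length; map; _++_; allFin; cartesianProductWith; cartesianProduct)
open import Data.List.Properties using (length-map; length-++; length-tabulate)
open import Data.List.Relation.Unary.All as All using ([])
import Data.List.Relation.Unary.All.Properties as Allₚ
open import Data.List.Relation.Unary.Any using (here; there)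
open import Data.List.Relation.Unary.AllPairs using ([]; _∷_)
open import Data.List.Relation.Unary.Unique.Propositional using (Unique)
import Data.List.Relation.Unary.Unique.Propositional.Properties as Uniqueₚ
open import Data.List.Membership.Propositional using () renaming (_∈_ to _∈ₗ_)
open import Data.List.Membership.Propositional.Properties
open import Data.Vec using (Vec; []; _∷_; lookup; tabulate)
open import Data.Vec.Properties using (lookup∘tabulate; tabulate∘lookup; tabulate-cong; []=⇒lookup; lookup⇒[]=; ∷-injective)
open import Relation.Binary.PropositionalEquality using (_≡_; _≢_; refl; sym; trans; cong; cong₂; subst; module ≡-Reasoning)
open import Relation.Binary.Definitions using (tri<; tri≈; tri>)
open import Relation.Nullary using (¬_; yes; no; does; contradiction)
open import Relation.Nullary.Decidable using (dec-true; _×-dec_; ¬?)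
open import Relation.Unary using (Pred; Decidable)
open import Function using (_∘_)
open import Function.Bundles using (mk⇔)
open import Level using (0ℓ)

Unique-map⁺ : ∀ {A B : Set} (f : A → B) {xs : List A} →
              (∀ {x y} → x ∈ₗ xs → y ∈ₗ xs → f x ≡ f y → x ≡ y) →
              Unique xs → Unique (map f xs)
Unique-map⁺ f inj [] = []
Unique-map⁺ f inj (x∉xs ∷ xs!) =
  Allₚ.map⁺ (All.tabulate λ y∈xs fx≡fy → All.lookup x∉xs y∈xs (inj (here refl) (there y∈xs) fx≡fy))
  ∷ Unique-map⁺ f (λ x∈ y∈ → inj (there x∈) (there y∈)) xs!

HasExactly-map : ∀ {A : Set} {n} {P : Subset n → Set} (xs : List A) (f : A → Subset n) →
                 Unique xs →
                 (∀ {x y} → x ∈ₗ xs → y ∈ₗ xs → f x ≡ f y → x ≡ y) →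
                 (∀ {x} → x ∈ₗ xs → P (f x)) →
                 (∀ {F} → P F → ∃ λ x → x ∈ₗ xs × F ≡ f x) →
                 HasExactly P (length xs)
HasExactly-map {P = P} xs f xs! inj sound complete =
  map f xs , Unique-map⁺ f inj xs! , (λ F → mk⇔ (⇒P F) (P⇒ F)) , length-map f xs
  where
  ⇒P : ∀ F → F ∈ₗ map f xs → P F
  ⇒P F F∈ with ∈-map⁻ f F∈
  ... | x , x∈xs , refl = sound x∈xs
  P⇒ : ∀ F → P F → F ∈ₗ map f xs
  P⇒ F PF with complete PF
  ... | x , x∈xs , refl = ∈-map⁺ f x∈xs

length-cartesianProductWith : ∀ {A B C : Set} (f : A → B → C) xs ys →
                              length (cartesianProductWith f xs ys) ≡ length xs * length ys
length-cartesianProductWith f [] ys = refl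
length-cartesianProductWith f (x ∷ xs) ys = begin
  length (map (f x) ys ++ cartesianProductWith f xs ys)
    ≡⟨ length-++ (map (f x) ys) ⟩
  length (map (f x) ys) + length (cartesianProductWith f xs ys)
    ≡⟨ cong₂ _+_ (length-map (f x) ys) (length-cartesianProductWith f xs ys) ⟩
  length ys + length xs * length ys ∎
  where open ≡-Reasoning

length-allFin : ∀ n → length (allFin n) ≡ n
length-allFin n = length-tabulate {n = n} (λ i → i)

allVecs : ∀ m k → List (Vec (Fin m) k)
allVecs m zero = [ [] ]
allVecs m (suc k) = cartesianProductWith _∷_ (allFin m) (allVecs m k)

length-allVecs : ∀ m k → length (allVecs m k) ≡ m ^ k
length-allVecs m zero = refl
length-allVecs m (suc k) =
  trans (length-cartesianProductWith _∷_ (allFin m) (allVecs m k))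
        (cong₂ _*_ (length-allFin m) (length-allVecs m k))

allVecs-unique : ∀ m k → Unique (allVecs m k)
allVecs-unique m zero = [] ∷ []
allVecs-unique m (suc k) =
  Uniqueₚ.cartesianProductWith⁺ _∷_ ∷-injective (Uniqueₚ.allFin⁺ m) (allVecs-unique m k)

∈-allVecs : ∀ {m k} (t : Vec (Fin m) k) → t ∈ₗ allVecs m k
∈-allVecs [] = here refl
∈-allVecs (p ∷ t) = ∈-cartesianProductWith⁺ _∷_ (∈-allFin p) (∈-allVecs t)

pairsFromZero : ∀ m → List (Fin (suc m) × Fin (suc m))
pairsFromZero m = map (λ c → zero , suc c) (allFin m)

increasingPairs : ∀ m → List (Fin m × Fin m)
increasingPairs zero = []
increasingPairs (suc m) = pairsFromZero m ++ map (Product.map suc suc) (increasingPairs m)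

length-increasingPairs : ∀ m → length (increasingPairs m) ≡ m C 2
length-increasingPairs zero = refl
length-increasingPairs (suc m) = begin
  length (pairsFromZero m ++ map (Product.map suc suc) (increasingPairs m))
    ≡⟨ length-++ (pairsFromZero m) ⟩
  length (pairsFromZero m) + length (map (Product.map suc suc) (increasingPairs m))
    ≡⟨ cong₂ _+_ (trans (length-map (λ c → zero , suc c) (allFin m)) (length-allFin m))
                 (trans (length-map (Product.map suc suc) (increasingPairs m)) (length-increasingPairs m)) ⟩
  m + m C 2
    ≡⟨ cong (_+ m C 2) (nC1≡n m) ⟨
  m C 1 + m C 2
    ≡⟨ nCk+nC[k+1]≡[n+1]C[k+1] m 1 ⟩
  suc m C 2 ∎
  where open ≡-Reasoning

increasingPairs-unique : ∀ m → Unique (increasingPairs m)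
increasingPairs-unique zero = []
increasingPairs-unique (suc m) =
  Uniqueₚ.++⁺ (Uniqueₚ.map⁺ (λ { refl → refl }) (Uniqueₚ.allFin⁺ m))
              (Uniqueₚ.map⁺ (λ { {_ , _} {_ , _} refl → refl }) (increasingPairs-unique m))
              disjoint
  where
  disjoint : ∀ {x} → ¬ (x ∈ₗ pairsFromZero m × x ∈ₗ map (Product.map suc suc) (increasingPairs m))
  disjoint (x∈ˡ , x∈ʳ) with ∈-map⁻ _ x∈ˡ | ∈-map⁻ _ x∈ʳ
  ... | _ , _ , refl | _ , _ , ()

∈-increasingPairs⁻ : ∀ {m} {a c : Fin m} → (a , c) ∈ₗ increasingPairs m → a < c
∈-increasingPairs⁻ {suc m} ac∈ with ∈-++⁻ (pairsFromZero m) ac∈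
... | inj₁ ac∈ˡ with ∈-map⁻ _ ac∈ˡ
...   | _ , _ , refl = s≤s z≤n
∈-increasingPairs⁻ {suc m} ac∈ | inj₂ ac∈ʳ with ∈-map⁻ _ ac∈ʳ
...   | _ , ac∈′ , refl = s≤s (∈-increasingPairs⁻ ac∈′)

∈-increasingPairs⁺ : ∀ {m} {a c : Fin m} → a < c → (a , c) ∈ₗ increasingPairs m
∈-increasingPairs⁺ {suc m} {zero} {suc c} _ =
  ∈-++⁺ˡ (∈-map⁺ (λ c → zero , suc c) (∈-allFin c))
∈-increasingPairs⁺ {suc m} {suc a} {suc c} (s≤s a<c) =
  ∈-++⁺ʳ (pairsFromZero m) (∈-map⁺ (Product.map suc suc) (∈-increasingPairs⁺ a<c))

module _ {n : ℕ} {P : Pred (Fin n) 0ℓ} (P? : Decidable P) where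

  subsetOf : Subset n
  subsetOf = tabulate (does ∘ P?)

  ∈-subsetOf⁺ : ∀ {x} → P x → x ∈ subsetOf
  ∈-subsetOf⁺ {x} Px = lookup⇒[]= x subsetOf (trans (lookup∘tabulate (does ∘ P?) x) (dec-true (P? x) Px))

  ∈-subsetOf⁻ : ∀ {x} → x ∈ subsetOf → P x
  ∈-subsetOf⁻ {x} x∈ with P? x | trans (sym (lookup∘tabulate (does ∘ P?) x)) ([]=⇒lookup x∈)
  ... | yes Px | _ = Px
  ... | no _   | ()

module _ {n : ℕ} where

  pair : Fin n → Fin n → Subset n
  pair x y = ⁅ x ⁆ ∪ ⁅ y ⁆

  x∈pair : ∀ x y → x ∈ pair x y
  x∈pair x y = x∈p∪q⁺ (inj₁ (x∈⁅x⁆ x))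

  y∈pair : ∀ x y → y ∈ pair x y
  y∈pair x y = x∈p∪q⁺ (inj₂ (x∈⁅x⁆ y))

  ∈pair⁻ : ∀ {x y z} → z ∈ pair x y → z ≡ x ⊎ z ≡ y
  ∈pair⁻ {x} {y} z∈ with x∈p∪q⁻ ⁅ x ⁆ ⁅ y ⁆ z∈
  ... | inj₁ z∈⁅x⁆ = inj₁ (x∈⁅y⁆⇒x≡y x z∈⁅x⁆)
  ... | inj₂ z∈⁅y⁆ = inj₂ (x∈⁅y⁆⇒x≡y y z∈⁅y⁆)

  pair⊆ : ∀ {x y} {F : Subset n} → x ∈ F → y ∈ F → pair x y ⊆ F
  pair⊆ x∈F y∈F z∈ with ∈pair⁻ z∈
  ... | inj₁ refl = x∈F
  ... | inj₂ refl = y∈F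

  pair-comm : ∀ x y → pair x y ≡ pair y x
  pair-comm x y = ∪-comm ⁅ x ⁆ ⁅ y ⁆

  pair-injective : ∀ {x y x′ y′} → pair x y ≡ pair x′ y′ →
                   (x ≡ x′ × y ≡ y′) ⊎ (x ≡ y′ × y ≡ x′)
  pair-injective {x} {y} {x′} {y′} eq
    with ∈pair⁻ (subst (x ∈_) eq (x∈pair x y)) | ∈pair⁻ (subst (y ∈_) eq (y∈pair x y))
       | ∈pair⁻ (subst (x′ ∈_) (sym eq) (x∈pair x′ y′)) | ∈pair⁻ (subst (y′ ∈_) (sym eq) (y∈pair x′ y′))
  ... | inj₁ refl | inj₂ refl | _         | _         = inj₁ (refl , refl)
  ... | inj₂ refl | inj₁ refl | _         | _         = inj₂ (refl , refl)
  ... | inj₁ refl | inj₁ refl | _         | inj₁ refl = inj₁ (refl , refl)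
  ... | inj₁ refl | inj₁ refl | _         | inj₂ refl = inj₁ (refl , refl)
  ... | inj₂ refl | inj₂ refl | inj₁ refl | _         = inj₁ (refl , refl)
  ... | inj₂ refl | inj₂ refl | inj₂ refl | _         = inj₁ (refl , refl)

  pair-pigeonhole : ∀ {x y a b c} → a ∈ pair x y → b ∈ pair x y → c ∈ pair x y →
                    a ≢ b → a ≢ c → b ≡ c
  pair-pigeonhole a∈ b∈ c∈ a≢b a≢c with ∈pair⁻ a∈ | ∈pair⁻ b∈ | ∈pair⁻ c∈
  ... | _         | inj₁ refl | inj₁ refl = refl
  ... | _         | inj₂ refl | inj₂ refl = refl
  ... | inj₁ refl | inj₁ refl | _         = contradiction refl a≢b
  ... | inj₂ refl | inj₂ refl | _         = contradiction refl a≢b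
  ... | inj₁ refl | _         | inj₁ refl = contradiction refl a≢c
  ... | inj₂ refl | _         | inj₂ refl = contradiction refl a≢c

module _ {n : ℕ} (H : SimpleGraph n) where

  minimalFort-⊇-fort⇒≡ : ∀ {F G} → IsMinimalFort H F → IsFort H G → G ⊆ F → F ≡ G
  minimalFort-⊇-fort⇒≡ {F} {G} (_ , noSmaller) G-fort G⊆F = ⊆-antisym F⊆G G⊆F
    where
    F⊆G : F ⊆ G
    F⊆G {x} x∈F with x ∈? G
    ... | yes x∈G = x∈G
    ... | no  x∉G = contradiction G-fort (noSmaller G (G⊆F , x , x∈F , x∉G))

  two-neighbours⇒¬exactlyOne : ∀ {F u w₁ w₂} → w₁ ∈ F → w₂ ∈ F → w₁ ≢ w₂ →
                               Adj H u w₁ → Adj H u w₂ → ¬ ExactlyOneNbrIn H F u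
  two-neighbours⇒¬exactlyOne w₁∈ w₂∈ w₁≢w₂ u~w₁ u~w₂ (_ , _ , _ , unique) =
    w₁≢w₂ (trans (unique _ w₁∈ u~w₁) (sym (unique _ w₂∈ u~w₂)))

  edge-adj : ∀ {x y a b} → Adj H x y → a ∈ pair x y → b ∈ pair x y → a ≢ b → Adj H a b
  edge-adj x~y a∈ b∈ a≢b with ∈pair⁻ a∈ | ∈pair⁻ b∈
  ... | inj₁ refl | inj₂ refl = x~y
  ... | inj₂ refl | inj₁ refl = symm H x~y
  ... | inj₁ refl | inj₁ refl = contradiction refl a≢b
  ... | inj₂ refl | inj₂ refl = contradiction refl a≢b

  -- The vertex of the edge missing from G has the other one as its only neighbour in G.
  edge-noProperFort : ∀ {x y} → Adj H x y → ∀ G → G ⊂ pair x y → ¬ IsFort H G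
  edge-noProperFort x~y G (G⊆ , z , z∈ , z∉G) ((w , w∈G) , noLoneNbr) =
    noLoneNbr z z∉G (w , w∈G , edge-adj x~y z∈ (G⊆ w∈G) z≢w , onlyW)
    where
    z≢w : z ≢ w
    z≢w refl = z∉G w∈G
    onlyW : ∀ w′ → w′ ∈ G → Adj H z w′ → w′ ≡ w
    onlyW w′ w′∈G z~w′ =
      pair-pigeonhole z∈ (G⊆ w′∈G) (G⊆ w∈G) (λ { refl → irrefl H z~w′ }) z≢w

-- The windmill Wd (m + 1, k): each of its k blades has m ≥ 2 leaves, and a leaf is addressed by
-- its blade and its position within the blade.
module Windmill (m′ k : ℕ) where

  m : ℕ
  m = suc (suc m′)

  H : SimpleGraph (suc (k * m))
  H = Wd (suc m) k

  blade : Fin (k * m) → Fin k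
  blade = quotient m

  position : Fin (k * m) → Fin m
  position = remainder {k} m

  leaf : Fin k → Fin m → Fin (suc (k * m))
  leaf b p = suc (combine b p)

  blade-combine : ∀ (b : Fin k) (p : Fin m) → blade (combine b p) ≡ b
  blade-combine b p = cong proj₁ (remQuot-combine b p)

  position-combine : ∀ (b : Fin k) (p : Fin m) → position (combine b p) ≡ p
  position-combine b p = cong proj₂ (remQuot-combine b p)

  leaf-position : ∀ {b i} → blade i ≡ b → leaf b (position i) ≡ suc i
  leaf-position {i = i} refl = cong suc (combine-remQuot {k} m i)

  blade-position-injective : ∀ {i j} → blade i ≡ blade j → position i ≡ position j → i ≡ j
  blade-position-injective same-blade same-position =
    suc-injective (trans (sym (leaf-position refl)) (trans (cong₂ leaf same-blade same-position) (leaf-position refl)))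

  leaf-injective : ∀ {b b′ p p′} → leaf b p ≡ leaf b′ p′ → b ≡ b′ × p ≡ p′
  leaf-injective {b} {b′} {p} {p′} eq =
    combine-injectiveˡ b p b′ p′ (suc-injective eq) , combine-injectiveʳ b p b′ p′ (suc-injective eq)

  leaf-adj : ∀ {b p q} → p ≢ q → Adj H (leaf b p) (leaf b q)
  leaf-adj {b} {p} {q} p≢q =
    leaf-leaf _ _ (p≢q ∘ combine-injectiveʳ b p b q) (trans (blade-combine b p) (sym (blade-combine b q)))

  leafNbr-blade : ∀ {b p l} → Adj H (leaf b p) (suc l) → blade l ≡ b
  leafNbr-blade {b} {p} (leaf-leaf _ _ _ same) = trans (sym same) (blade-combine b p)

  anotherPosition : Fin m → Fin m
  anotherPosition zero    = suc zero
  anotherPosition (suc _) = zero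

  anotherPosition-≢ : ∀ p → anotherPosition p ≢ p
  anotherPosition-≢ zero    ()
  anotherPosition-≢ (suc _) ()

  IsStarVertex : Vec (Fin m) k → Pred (Fin (suc (k * m))) 0ℓ
  IsStarVertex t zero    = ⊤
  IsStarVertex t (suc i) = lookup t (blade i) ≡ position i

  isStarVertex? : ∀ t → Decidable (IsStarVertex t)
  isStarVertex? t zero    = yes tt
  isStarVertex? t (suc i) = lookup t (blade i) ≟ᶠ position i

  star : Vec (Fin m) k → Subset (suc (k * m))
  star t = subsetOf (isStarVertex? t)

  centre∈star : ∀ t → zero ∈ star t
  centre∈star t = ∈-subsetOf⁺ (isStarVertex? t) tt

  leaf∈star : ∀ t b → leaf b (lookup t b) ∈ star t
  leaf∈star t b = ∈-subsetOf⁺ (isStarVertex? t)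
    (trans (cong (lookup t) (blade-combine b _)) (sym (position-combine b _)))

  star-leaf-unique : ∀ t {i j} → suc i ∈ star t → suc j ∈ star t → blade i ≡ blade j → i ≡ j
  star-leaf-unique t {i} {j} i∈ j∈ same = blade-position-injective same (begin
    position i          ≡⟨ ∈-subsetOf⁻ (isStarVertex? t) i∈ ⟨
    lookup t (blade i)  ≡⟨ cong (lookup t) same ⟩
    lookup t (blade j)  ≡⟨ ∈-subsetOf⁻ (isStarVertex? t) j∈ ⟩
    position j          ∎)
    where open ≡-Reasoning

  star-isFort : ∀ t → IsFort H (star t)
  star-isFort t = (zero , centre∈star t) , noLoneNbr
    where
    noLoneNbr : ∀ u → u ∉ star t → ¬ ExactlyOneNbrIn H (star t) u
    noLoneNbr zero    u∉ = contradiction (centre∈star t) u∉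
    noLoneNbr (suc i) u∉ =
      two-neighbours⇒¬exactlyOne H (centre∈star t) (leaf∈star t (blade i)) (λ ()) (leaf-centre i)
        (subst (λ u → Adj H u (leaf (blade i) (lookup t (blade i)))) (leaf-position refl)
               (leaf-adj (λ i-chosen → u∉ (∈-subsetOf⁺ (isStarVertex? t) (sym i-chosen)))))

  star-noProperFort : ∀ t G → G ⊂ star t → ¬ IsFort H G
  star-noProperFort t G (G⊆ , x , x∈ , x∉G) ((y , y∈G) , noLoneNbr) with zero ∈? G
  ... | yes centre∈G = missingLeaf x x∈ x∉G
    where
    -- a star leaf missing from G sees only the centre in G
    missingLeaf : ∀ x → x ∈ star t → x ∉ G → ⊥
    missingLeaf zero    _  x∉G = x∉G centre∈G
    missingLeaf (suc i) i∈ i∉G = noLoneNbr (suc i) i∉G (zero , centre∈G , leaf-centre i , onlyCentre)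
      where
      onlyCentre : ∀ w → w ∈ G → Adj H (suc i) w → w ≡ zero
      onlyCentre zero    _   _ = refl
      onlyCentre (suc j) j∈G (leaf-leaf _ _ i≢j same) =
        contradiction (star-leaf-unique t i∈ (G⊆ j∈G) same) i≢j
  ... | no centre∉G = loneLeaf y y∈G
    where
    -- a leaf of G has a blade-mate outside G which sees only it
    loneLeaf : ∀ y → y ∈ G → ⊥
    loneLeaf zero    = centre∉G
    loneLeaf (suc j) j∈G = noLoneNbr u u∉G (suc j , j∈G , u~j , onlyJ)
      where
      u : Fin (suc (k * m))
      u = leaf (blade j) (anotherPosition (position j))
      u~j : Adj H u (suc j)
      u~j = subst (Adj H u) (leaf-position refl) (leaf-adj (anotherPosition-≢ (position j)))
      onlyJ : ∀ w → w ∈ G → Adj H u w → w ≡ suc j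
      onlyJ zero    w∈G _   = contradiction w∈G centre∉G
      onlyJ (suc l) l∈G u~l = cong suc (star-leaf-unique t (G⊆ l∈G) (G⊆ j∈G) (leafNbr-blade u~l))
      u∉G : u ∉ G
      u∉G u∈G = anotherPosition-≢ (position j)
        (trans (sym (position-combine (blade j) _))
               (cong position (star-leaf-unique t (G⊆ u∈G) (G⊆ j∈G) (blade-combine (blade j) _))))

  star-isMinimalFort : ∀ t → IsMinimalFort H (star t)
  star-isMinimalFort t = star-isFort t , star-noProperFort t

  fort∋centre-meetsBlade : ∀ {F} → IsFort H F → zero ∈ F → ∀ b → ∃ λ p → leaf b p ∈ F
  fort∋centre-meetsBlade {F} (_ , noLoneNbr) centre∈F b with any? (λ p → leaf b p ∈? F)
  ... | yes found = found
  ... | no  none  =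
    ⊥-elim (noLoneNbr (leaf b zero) (λ u∈F → none (zero , u∈F)) (zero , centre∈F , leaf-centre _ , onlyCentre))
    where
    onlyCentre : ∀ w → w ∈ F → Adj H (leaf b zero) w → w ≡ zero
    onlyCentre zero    _   _   = refl
    onlyCentre (suc l) l∈F u~l =
      ⊥-elim (none (position l , subst (_∈ F) (sym (leaf-position (leafNbr-blade u~l))) l∈F))

  minimalFort∋centre⇒star : ∀ {F} → IsMinimalFort H F → zero ∈ F → ∃ λ t → F ≡ star t
  minimalFort∋centre⇒star {F} F-min@(F-fort , _) centre∈F =
    t , minimalFort-⊇-fort⇒≡ H F-min (star-isFort t) star⊆F
    where
    choice : ∀ b → ∃ λ p → leaf b p ∈ F
    choice = fort∋centre-meetsBlade F-fort centre∈F
    t : Vec (Fin m) k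
    t = tabulate (proj₁ ∘ choice)
    star⊆F : star t ⊆ F
    star⊆F {zero}  _  = centre∈F
    star⊆F {suc i} i∈ =
      subst (_∈ F) (trans (cong (leaf (blade i)) chosen≡) (leaf-position refl)) (proj₂ (choice (blade i)))
      where
      chosen≡ : proj₁ (choice (blade i)) ≡ position i
      chosen≡ = trans (sym (lookup∘tabulate (proj₁ ∘ choice) (blade i))) (∈-subsetOf⁻ (isStarVertex? t) i∈)

  star-injective : ∀ {t t′} → star t ≡ star t′ → t ≡ t′
  star-injective {t} {t′} eq = begin
    t                     ≡⟨ tabulate∘lookup t ⟨
    tabulate (lookup t)   ≡⟨ tabulate-cong same ⟩
    tabulate (lookup t′)  ≡⟨ tabulate∘lookup t′ ⟩
    t′                    ∎
    where
    open ≡-Reasoning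
    same : ∀ b → lookup t b ≡ lookup t′ b
    same b = sym (begin
      lookup t′ b
        ≡⟨ cong (lookup t′) (blade-combine b _) ⟨
      lookup t′ (blade (combine b (lookup t b)))
        ≡⟨ ∈-subsetOf⁻ (isStarVertex? t′) (subst (leaf b (lookup t b) ∈_) eq (leaf∈star t b)) ⟩
      position (combine b (lookup t b))
        ≡⟨ position-combine b _ ⟩
      lookup t b ∎)

  minimalForts-withCentre : HasExactly (λ F → IsMinimalFort H F × zero ∈ F) (m ^ k)
  minimalForts-withCentre = subst (HasExactly _) (length-allVecs m k)
    (HasExactly-map (allVecs m k) star (allVecs-unique m k) (λ _ _ → star-injective)
      (λ {t} _ → star-isMinimalFort t , centre∈star t)
      (λ (F-min , centre∈F) → let t , F≡ = minimalFort∋centre⇒star F-min centre∈F in t , ∈-allVecs t , F≡))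

  leafPair : Fin k → Fin m → Fin m → Subset (suc (k * m))
  leafPair b p q = pair (leaf b p) (leaf b q)

  p∈leafPair : ∀ b p q → leaf b p ∈ leafPair b p q
  p∈leafPair b p q = x∈pair (leaf b p) (leaf b q)

  q∈leafPair : ∀ b p q → leaf b q ∈ leafPair b p q
  q∈leafPair b p q = y∈pair (leaf b p) (leaf b q)

  centre∉leafPair : ∀ b p q → zero ∉ leafPair b p q
  centre∉leafPair b p q centre∈ with ∈pair⁻ {x = leaf b p} {y = leaf b q} centre∈
  ... | inj₁ ()
  ... | inj₂ ()

  -- Outside the pair, only the centre and the leaves of blade b have neighbours in it, and they have two.
  leafPair-isFort : ∀ b {p q} → p ≢ q → IsFort H (leafPair b p q)
  leafPair-isFort b {p} {q} p≢q = (leaf b p , p∈leafPair b p q) , noLoneNbr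
    where
    leaves≢ : leaf b p ≢ leaf b q
    leaves≢ = p≢q ∘ proj₂ ∘ leaf-injective
    noLoneNbr : ∀ u → u ∉ leafPair b p q → ¬ ExactlyOneNbrIn H (leafPair b p q) u
    noLoneNbr zero _ =
      two-neighbours⇒¬exactlyOne H (p∈leafPair b p q) (q∈leafPair b p q) leaves≢ (centre-leaf _) (centre-leaf _)
    noLoneNbr (suc i) i∉ lone@(w , w∈ , i~w , _) =
      two-neighbours⇒¬exactlyOne H (p∈leafPair b p q) (q∈leafPair b p q) leaves≢
        (i~ (p∈leafPair b p q)) (i~ (q∈leafPair b p q)) lone
      where
      blade-i : blade i ≡ b
      blade-i = [ viaW , viaW ]′ (∈pair⁻ {x = leaf b p} {y = leaf b q} w∈)
        where
        viaW : ∀ {s} → w ≡ leaf b s → blade i ≡ b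
        viaW w≡ = leafNbr-blade (symm H (subst (Adj H (suc i)) w≡ i~w))
      i~ : ∀ {s} → leaf b s ∈ leafPair b p q → Adj H (suc i) (leaf b s)
      i~ {s} s∈ = subst (λ u → Adj H u (leaf b s)) (leaf-position blade-i)
        (leaf-adj λ { refl → i∉ (subst (_∈ leafPair b p q) (leaf-position blade-i) s∈) })

  leafPair-isMinimalFort : ∀ b {p q} → p ≢ q → IsMinimalFort H (leafPair b p q)
  leafPair-isMinimalFort b p≢q = leafPair-isFort b p≢q , edge-noProperFort H (leaf-adj p≢q)

  fort∌centre-leafHasBladeMate : ∀ {F} → IsFort H F → zero ∉ F →
                                 ∀ {b p} → leaf b p ∈ F → ∃ λ q → q ≢ p × leaf b q ∈ F
  fort∌centre-leafHasBladeMate {F} (_ , noLoneNbr) centre∉F {b} {p} p∈F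
    with any? (λ q → ¬? (q ≟ᶠ p) ×-dec (leaf b q ∈? F))
  ... | yes found = found
  ... | no  none  = ⊥-elim (noLoneNbr u u∉F (leaf b p , p∈F , leaf-adj (anotherPosition-≢ p) , onlyP))
    where
    u : Fin (suc (k * m))
    u = leaf b (anotherPosition p)
    u∉F : u ∉ F
    u∉F u∈F = none (anotherPosition p , anotherPosition-≢ p , u∈F)
    onlyP : ∀ w → w ∈ F → Adj H u w → w ≡ leaf b p
    onlyP zero    w∈F _ = contradiction w∈F centre∉F
    onlyP (suc l) l∈F u~l with position l ≟ᶠ p
    ... | yes l≡p = trans (sym (leaf-position (leafNbr-blade u~l))) (cong (leaf b) l≡p)
    ... | no  l≢p =
      ⊥-elim (none (position l , l≢p , subst (_∈ F) (sym (leaf-position (leafNbr-blade u~l))) l∈F))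

  minimalFort∌centre⇒leafPair : ∀ {F} → IsMinimalFort H F → zero ∉ F →
                                ∃ λ b → ∃₂ λ p q → p ≢ q × F ≡ leafPair b p q
  minimalFort∌centre⇒leafPair {F} F-min@(F-fort@((x , x∈F) , _) , _) centre∉F = fromMember x x∈F
    where
    fromMember : ∀ x → x ∈ F → ∃ λ b → ∃₂ λ p q → p ≢ q × F ≡ leafPair b p q
    fromMember zero centre∈F = contradiction centre∈F centre∉F
    fromMember (suc j) j∈F =
      let q , q≢p , q∈F = fort∌centre-leafHasBladeMate F-fort centre∉F p∈F in
      blade j , position j , q , q≢p ∘ sym ,
      minimalFort-⊇-fort⇒≡ H F-min (leafPair-isFort (blade j) (q≢p ∘ sym)) (pair⊆ p∈F q∈F)
      where
      p∈F : leaf (blade j) (position j) ∈ F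
      p∈F = subst (_∈ F) (sym (leaf-position refl)) j∈F

  leafPairIndices : List (Fin k × Fin m × Fin m)
  leafPairIndices = cartesianProduct (allFin k) (increasingPairs m)

  ∈-leafPairIndices⁻ : ∀ {b p q} → (b , p , q) ∈ₗ leafPairIndices → p < q
  ∈-leafPairIndices⁻ = ∈-increasingPairs⁻ ∘ proj₂ ∘ ∈-cartesianProduct⁻ (allFin k) (increasingPairs m)

  ∈-leafPairIndices⁺ : ∀ b {p q} → p < q → (b , p , q) ∈ₗ leafPairIndices
  ∈-leafPairIndices⁺ b p<q = ∈-cartesianProduct⁺ (∈-allFin b) (∈-increasingPairs⁺ p<q)

  minimalForts-withoutCentre : HasExactly (λ F → IsMinimalFort H F × zero ∉ F) (k * (m C 2))
  minimalForts-withoutCentre = subst (HasExactly _) count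
    (HasExactly-map leafPairIndices leafPairAt
      (Uniqueₚ.cartesianProduct⁺ (Uniqueₚ.allFin⁺ k) (increasingPairs-unique m))
      injective sound complete)
    where
    leafPairAt : Fin k × Fin m × Fin m → Subset (suc (k * m))
    leafPairAt (b , p , q) = leafPair b p q

    count : length leafPairIndices ≡ k * (m C 2)
    count = trans (length-cartesianProductWith _,_ (allFin k) (increasingPairs m))
                  (cong₂ _*_ (length-allFin k) (length-increasingPairs m))

    injective : ∀ {x y} → x ∈ₗ leafPairIndices → y ∈ₗ leafPairIndices →
                leafPairAt x ≡ leafPairAt y → x ≡ y
    injective x∈ y∈ eq with pair-injective eq
    ... | inj₁ (p≡p′ , q≡q′) with leaf-injective p≡p′ | leaf-injective q≡q′
    ...   | refl , refl | _ , refl = refl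
    injective x∈ y∈ eq | inj₂ (p≡q′ , q≡p′) with leaf-injective p≡q′ | leaf-injective q≡p′
    ...   | refl , refl | _ , refl = contradiction (∈-leafPairIndices⁻ x∈) (<-asym (∈-leafPairIndices⁻ y∈))

    sound : ∀ {x} → x ∈ₗ leafPairIndices → IsMinimalFort H (leafPairAt x) × zero ∉ leafPairAt x
    sound {b , p , q} x∈ = leafPair-isMinimalFort b (<⇒≢ (∈-leafPairIndices⁻ x∈)) , centre∉leafPair b p q

    complete : ∀ {F} → IsMinimalFort H F × zero ∉ F → ∃ λ x → x ∈ₗ leafPairIndices × F ≡ leafPairAt x
    complete (F-min , centre∉F) with minimalFort∌centre⇒leafPair F-min centre∉F
    ... | b , p , q , p≢q , F≡ with <-cmp p q
    ...   | tri< p<q _ _ = (b , p , q) , ∈-leafPairIndices⁺ b p<q , F≡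
    ...   | tri≈ _ p≡q _ = contradiction p≡q p≢q
    ...   | tri> _ _ q<p =
      (b , q , p) , ∈-leafPairIndices⁺ b q<p , trans F≡ (pair-comm (leaf b p) (leaf b q))

corollary5p9 : (r k : ℕ) → r ≥ 3 → k ≥ 2 →
    HasExactly (λ F → IsMinimalFort (Wd r k) F × centre r k ∈ F) ((r ∸ 1) ^ k)
      × HasExactly (λ F → IsMinimalFort (Wd r k) F × centre r k ∉ F) (k * ((r ∸ 1) C 2))
corollary5p9 (suc (suc (suc m′))) k (s≤s (s≤s (s≤s _))) _ =
  Windmill.minimalForts-withCentre m′ k , Windmill.minimalForts-withoutCentre m′ k
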